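{- A graph is switching equivalent to a threshold graph if and only if it is a restricted 2-threshold graph.
   Context: Graphs are finite and simple. A threshold graph is a graph in which every induced subgraph has an isolated vertex or a universal vertex. For $G=(V,E)$ and $S\subseteq V$, switching $G$ with respect to $S$ means: for every pair $\{u,v\}$ with $u\in S$, $v\notin S$, add the edge if absent and remove it if present; other pairs are unchanged. Two graphs are switching equivalent if one is obtained from the other by switching with respect to some vertex subset. Consider black/white colorings of the vertices (any map). A graph is a restricted 2-threshold graph if for some black/white coloring there is an ordering $v_1,\ldots,v_n$ of its vertices and, for each $j\ge 2$, an operator $\otimes_b$ or $\otimes_w$ such that $v_j$ is adjacent among $v_1,\ldots,v_{j-1}$ exactly to the black vertices (if its operator is $\otimes_b$) or exactly to the white vertices (if $\otimes_w$). -}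

module Defs where

open import Data.Nat using (ℕ)
open import Data.Fin using (Fin; _<_)
open import Data.Fin.Permutation using (Permutation′; _⟨$⟩ʳ_)
open import Data.Bool using (Bool; true; false; not; _xor_)
open import Data.Product using (Σ; ∃; _×_)
open import Data.Sum using (_⊎_)
open import Relation.Binary.PropositionalEquality using (_≡_; _≢_)

record Graph (n : ℕ) : Set where
  field
    adj    : Fin n → Fin n → Bool
    sym    : ∀ u v → adj u v ≡ adj v u
    irrefl : ∀ v → adj v v ≡ false
open Graph public

VSubset : ℕ → Set
VSubset n = Fin n → Bool

IsolatedIn : ∀ {n} → Graph n → VSubset n → Fin n → Set
IsolatedIn G S v = ∀ u → S u ≡ true → u ≢ v → adj G u v ≡ false

UniversalIn : ∀ {n} → Graph n → VSubset n → Fin n → Set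
UniversalIn G S v = ∀ u → S u ≡ true → u ≢ v → adj G u v ≡ true

IsThreshold : ∀ {n} → Graph n → Set
IsThreshold {n} G =
  ∀ (S : VSubset n) → ∃ (λ w → S w ≡ true) →
  ∃ λ v → S v ≡ true × (IsolatedIn G S v ⊎ UniversalIn G S v)

switchAdj : ∀ {n} → Graph n → VSubset n → Fin n → Fin n → Bool
switchAdj G S u v = adj G u v xor (S u xor S v)

SwitchingEquivalent : ∀ {n} → Graph n → Graph n → Set
SwitchingEquivalent {n} G H =
  ∃ λ (S : VSubset n) → ∀ u v → switchAdj G S u v ≡ adj H u v

-- Colours: true = black, false = white.
-- Operators: true = ⊗_b, false = ⊗_w.
-- Vertex x is adjacent to later vertex under operator op iff colour x = op.
sameColour : Bool → Bool → Bool
sameColour a b = not (a xor b)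

-- Restricted 2-threshold graph: there is a colouring c, an ordering
-- v_1..v_n (given by a permutation σ : position ↦ vertex) and operators
-- (op j for position j; the operator at the first position is irrelevant)
-- such that for positions i < j, v_j ~ v_i iff colour(v_i) matches op j.
IsRestricted2Threshold : ∀ {n} → Graph n → Set
IsRestricted2Threshold {n} G =
  Σ (Fin n → Bool) λ c →
  Σ (Permutation′ n) λ σ →
  Σ (Fin n → Bool) λ op →
  ∀ (i j : Fin n) → i < j →
    adj G (σ ⟨$⟩ʳ j) (σ ⟨$⟩ʳ i) ≡ sameColour (c (σ ⟨$⟩ʳ i)) (op j)

-- The bridge between the two sides is the notion of a creation sequence:
-- an ordering v₁ … vₙ of the vertices together with flags such that each
-- v_j is adjacent to all earlier vertices (flag true) or to none of them
-- (flag false).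
--
--  * A graph is threshold iff it has a creation sequence.  Given a
--    sequence, the last vertex of any subset S in the order is isolated or
--    universal in S.  Conversely, a threshold graph has an isolated or
--    universal vertex w; deleting it leaves a threshold graph, whose
--    creation sequence is extended by appending w as the last vertex.
--  * For a colouring c, an ordering is a restricted 2-threshold
--    representation of G with colouring c iff the same ordering is a
--    creation sequence of G switched with respect to the black vertices of c.
--    This is a pointwise Boolean identity: switching flips the adjacency of
--    v_i and v_j by c(v_i) xor c(v_j), which cancels the dependence on the
--    colour of the earlier vertex v_i.
--
-- Taking the switching set to be the colouring, theorem8 follows by
-- composing the two halves.

module Submission where

open import Defs renaming (sym to adj-sym)
open import Data.Nat using (ℕ; zero; suc; z≤n; s≤s)
import Data.Nat.Properties as ℕ
open import Data.Bool using (Bool; true; false; not; _xor_)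
open import Data.Bool.Properties using (xor-assoc; xor-comm; xor-same; xor-identityʳ)
import Data.Bool.Properties as Bool
open import Data.Fin using (Fin; zero; suc; _<_; _≤_; punchIn; punchOut; fromℕ; _≟_)
open import Data.Fin.Properties
  using (any?; ≤fromℕ; ≤∧≢⇒<; <⇒≢; punchInᵢ≢i; punchIn-injective;
         punchIn-punchOut; punchOut-injective; punchOut-mono-≤)
open import Data.Fin.Permutation
  using (Permutation; Permutation′; _⟨$⟩ʳ_; _⟨$⟩ˡ_; inverseʳ; insert; insert-punchIn)
import Data.Fin.Permutation as Perm
open import Data.Vec.Functional using (insertAt)
open import Data.Vec.Functional.Properties using (insertAt-lookup; insertAt-punchIn)
open import Data.Product using (Σ; ∃; _×_; _,_)
open import Data.Sum using (_⊎_; inj₁; inj₂)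
open import Data.Empty using (⊥-elim)
open import Function using (_∘_)
open import Function.Bundles using (_⇔_; mk⇔; Equivalence)
open import Relation.Nullary using (yes; no)
open import Relation.Binary.PropositionalEquality
  using (_≡_; _≢_; refl; sym; trans; cong; cong₂; subst; subst₂; module ≡-Reasoning)

-- Switching by a colouring: the colour of the earlier vertex cancels, so
-- "adjacent iff colour c(v_i) matches o" becomes "adjacent iff not (o xor c(v_j))".
switched-colour-rule : ∀ ci cj o → sameColour ci o xor (cj xor ci) ≡ not (o xor cj)
switched-colour-rule true  true  true  = refl
switched-colour-rule true  true  false = refl
switched-colour-rule true  false true  = refl
switched-colour-rule true  false false = refl
switched-colour-rule false true  true  = refl
switched-colour-rule false true  false = refl
switched-colour-rule false false true  = refl
switched-colour-rule false false false = refl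

-- The operator ↦ flag translation of switched-colour-rule is an involution.
not-xor-involutive : ∀ d c → not (not (d xor c) xor c) ≡ d
not-xor-involutive true  true  = refl
not-xor-involutive true  false = refl
not-xor-involutive false true  = refl
not-xor-involutive false false = refl

xor-cancelʳ : ∀ x y z → x xor y ≡ z xor y → x ≡ z
xor-cancelʳ x y z e = begin
  x                 ≡⟨ sym (undo x) ⟩
  (x xor y) xor y   ≡⟨ cong (_xor y) e ⟩
  (z xor y) xor y   ≡⟨ undo z ⟩
  z                 ∎
  where
  open ≡-Reasoning
  undo : ∀ a → (a xor y) xor y ≡ a
  undo a = trans (xor-assoc a y y) (trans (cong (a xor_) (xor-same y)) (xor-identityʳ a))

switch : ∀ {n} → Graph n → VSubset n → Graph n
switch G S = record
  { adj    = switchAdj G S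
  ; sym    = λ u v → cong₂ _xor_ (adj-sym G u v) (xor-comm (S u) (S v))
  ; irrefl = λ v → cong₂ _xor_ (irrefl G v) (xor-same (S v))
  }

CreationSequence : ∀ {n} → Graph n → Set
CreationSequence {n} H =
  Σ (Permutation′ n) λ σ →
  Σ (Fin n → Bool) λ d →
  ∀ (i j : Fin n) → i < j → adj H (σ ⟨$⟩ʳ j) (σ ⟨$⟩ʳ i) ≡ d j

creation-transport : ∀ {n} (G H : Graph n) →
  (∀ u v → adj G u v ≡ adj H u v) → CreationSequence G → CreationSequence H
creation-transport G H G≈H (σ , d , joins) =
  σ , d , λ i j i<j → trans (sym (G≈H _ _)) (joins i j i<j)

ColouredOrdering : ∀ {n} → Graph n → (Fin n → Bool) → Set
ColouredOrdering {n} G c =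
  Σ (Permutation′ n) λ σ →
  Σ (Fin n → Bool) λ op →
  ∀ (i j : Fin n) → i < j →
    adj G (σ ⟨$⟩ʳ j) (σ ⟨$⟩ʳ i) ≡ sameColour (c (σ ⟨$⟩ʳ i)) (op j)

coloured⇔switched-creation : ∀ {n} (G : Graph n) (c : Fin n → Bool) →
  ColouredOrdering G c ⇔ CreationSequence (switch G c)
coloured⇔switched-creation G c = mk⇔ to from
  where
  to : ColouredOrdering G c → CreationSequence (switch G c)
  to (σ , op , rule) = σ , (λ j → not (op j xor c (σ ⟨$⟩ʳ j))) , λ i j i<j →
    trans (cong (_xor (c (σ ⟨$⟩ʳ j) xor c (σ ⟨$⟩ʳ i))) (rule i j i<j))
          (switched-colour-rule (c (σ ⟨$⟩ʳ i)) (c (σ ⟨$⟩ʳ j)) (op j))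

  from : CreationSequence (switch G c) → ColouredOrdering G c
  from (σ , d , joins) = σ , op , λ i j i<j →
    xor-cancelʳ _ _ _ (begin
      adj G (σ ⟨$⟩ʳ j) (σ ⟨$⟩ʳ i) xor (c (σ ⟨$⟩ʳ j) xor c (σ ⟨$⟩ʳ i))
        ≡⟨ joins i j i<j ⟩
      d j
        ≡⟨ sym (not-xor-involutive (d j) (c (σ ⟨$⟩ʳ j))) ⟩
      not (op j xor c (σ ⟨$⟩ʳ j))
        ≡⟨ sym (switched-colour-rule (c (σ ⟨$⟩ʳ i)) (c (σ ⟨$⟩ʳ j)) (op j)) ⟩
      sameColour (c (σ ⟨$⟩ʳ i)) (op j) xor (c (σ ⟨$⟩ʳ j) xor c (σ ⟨$⟩ʳ i)) ∎)
    where
    open ≡-Reasoning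
    op : Fin _ → Bool
    op j = not (d j xor c (σ ⟨$⟩ʳ j))

UniformIn : ∀ {n} → Graph n → VSubset n → Fin n → Bool → Set
UniformIn H S v b = ∀ u → S u ≡ true → u ≢ v → adj H u v ≡ b

uniform⇒isolated-or-universal : ∀ {n} (H : Graph n) {S v} b →
  UniformIn H S v b → IsolatedIn H S v ⊎ UniversalIn H S v
uniform⇒isolated-or-universal H false uniform = inj₁ uniform
uniform⇒isolated-or-universal H true  uniform = inj₂ uniform

isolated-or-universal⇒uniform : ∀ {n} (H : Graph n) {S v} →
  IsolatedIn H S v ⊎ UniversalIn H S v → ∃ (UniformIn H S v)
isolated-or-universal⇒uniform H (inj₁ isolated)  = false , isolated
isolated-or-universal⇒uniform H (inj₂ universal) = true , universal

greatest : ∀ {n} (P : Fin n → Bool) → ∃ (λ p → P p ≡ true) →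
  ∃ λ p → P p ≡ true × (∀ q → P q ≡ true → q ≤ p)
greatest {suc n} P witness with any? (λ q → P (suc q) Bool.≟ true)
... | yes later with greatest (P ∘ suc) later
...   | p , Pp , below = suc p , Pp , bound
  where
  bound : ∀ q → P q ≡ true → q ≤ suc p
  bound zero    _  = z≤n
  bound (suc q) Pq = s≤s (below q Pq)
greatest {suc n} P (zero , P0) | no none = zero , P0 , bound
  where
  bound : ∀ q → P q ≡ true → q ≤ zero {n}
  bound zero    _  = z≤n
  bound (suc q) Pq = ⊥-elim (none (q , Pq))
greatest {suc n} P (suc w , Pw) | no none = ⊥-elim (none (w , Pw))

-- The vertex of S occurring last in a creation sequence is joined to all
-- other vertices of S according to its flag.
creation⇒threshold : ∀ {n} (H : Graph n) → CreationSequence H → IsThreshold H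
creation⇒threshold H (σ , d , joins) S (w , w∈S)
  with greatest (S ∘ (σ ⟨$⟩ʳ_)) (σ ⟨$⟩ˡ w , trans (cong S (inverseʳ σ)) w∈S)
... | p , p∈S , last = σ ⟨$⟩ʳ p , p∈S , uniform⇒isolated-or-universal H (d p) joined
  where
  open ≡-Reasoning
  joined : UniformIn H S (σ ⟨$⟩ʳ p) (d p)
  joined u u∈S u≢σp = begin
    adj H u (σ ⟨$⟩ʳ p)                    ≡⟨ cong (λ x → adj H x (σ ⟨$⟩ʳ p)) (sym (inverseʳ σ)) ⟩
    adj H (σ ⟨$⟩ʳ (σ ⟨$⟩ˡ u)) (σ ⟨$⟩ʳ p)  ≡⟨ adj-sym H _ _ ⟩
    adj H (σ ⟨$⟩ʳ p) (σ ⟨$⟩ʳ (σ ⟨$⟩ˡ u))  ≡⟨ joins (σ ⟨$⟩ˡ u) p earlier ⟩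
    d p                                   ∎
    where
    earlier : σ ⟨$⟩ˡ u < p
    earlier = ≤∧≢⇒< (last (σ ⟨$⟩ˡ u) (trans (cong S (inverseʳ σ)) u∈S))
                    (λ e → u≢σp (trans (sym (inverseʳ σ)) (cong (σ ⟨$⟩ʳ_) e)))

deleteVertex : ∀ {n} → Graph (suc n) → Fin (suc n) → Graph n
deleteVertex H w = record
  { adj    = λ a b → adj H (punchIn w a) (punchIn w b)
  ; sym    = λ a b → adj-sym H _ _
  ; irrefl = λ a → irrefl H _
  }

-- Deleting a vertex preserves being threshold: a subset S' of
-- H - w is the subset insertAt S' w false of H, which avoids w.
deleteVertex-threshold : ∀ {n} (H : Graph (suc n)) w →
  IsThreshold H → IsThreshold (deleteVertex H w)
deleteVertex-threshold H w threshold S' (a₀ , a₀∈S')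
  with threshold (insertAt S' w false) (punchIn w a₀ , trans (insertAt-punchIn S' w false a₀) a₀∈S')
... | v , v∈S , iso-or-univ with isolated-or-universal⇒uniform H iso-or-univ
...   | b , uniform = a , a∈S' , uniform⇒isolated-or-universal (deleteVertex H w) b uniform′
  where
  S : VSubset _
  S = insertAt S' w false
  w≢v : w ≢ v
  w≢v refl with trans (sym (insertAt-lookup S' w false)) v∈S
  ... | ()
  a : Fin _
  a = punchOut w≢v
  a↦v : punchIn w a ≡ v
  a↦v = punchIn-punchOut w≢v
  a∈S' : S' a ≡ true
  a∈S' = trans (sym (insertAt-punchIn S' w false a)) (subst (λ x → S x ≡ true) (sym a↦v) v∈S)
  uniform′ : UniformIn (deleteVertex H w) S' a b
  uniform′ u u∈S' u≢a =
    subst (λ x → adj H (punchIn w u) x ≡ b) (sym a↦v)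
      (uniform (punchIn w u) (trans (insertAt-punchIn S' w false u) u∈S')
               (λ e → u≢a (punchIn-injective w u a (trans e (sym a↦v)))))

positions-below-last : ∀ {n} (P : Fin (suc n) → Fin (suc n) → Set) →
  (∀ k → P (punchIn (fromℕ n) k) (fromℕ n)) →
  (∀ k l → k < l → P (punchIn (fromℕ n) k) (punchIn (fromℕ n) l)) →
  ∀ i j → i < j → P i j
positions-below-last {n} P at-last inside i j i<j with fromℕ n ≟ i | fromℕ n ≟ j
... | yes refl | _        = ⊥-elim (ℕ.<⇒≱ i<j (≤fromℕ j))
... | no L≢i   | yes refl = subst (λ x → P x (fromℕ n)) (punchIn-punchOut L≢i) (at-last _)
... | no L≢i   | no L≢j   = subst₂ P (punchIn-punchOut L≢i) (punchIn-punchOut L≢j)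
  (inside _ _ (≤∧≢⇒< (punchOut-mono-≤ L≢i L≢j (ℕ.<⇒≤ i<j))
                     (<⇒≢ i<j ∘ punchOut-injective L≢i L≢j)))

insert-pivot : ∀ {m n} i j (π : Permutation m n) → insert i j π ⟨$⟩ʳ i ≡ j
insert-pivot i j π with i ≟ i
... | yes _  = refl
... | no i≢i = ⊥-elim (i≢i refl)

append-uniform-vertex : ∀ {n} (H : Graph (suc n)) w b →
  (∀ u → u ≢ w → adj H u w ≡ b) →
  CreationSequence (deleteVertex H w) → CreationSequence H
append-uniform-vertex {n} H w b uniform (σ′ , d′ , joins′) =
  σ , d , positions-below-last Joins at-last inside
  where
  L : Fin (suc n)
  L = fromℕ n
  σ : Permutation′ (suc n)
  σ = insert L w σ′
  d : Fin (suc n) → Bool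
  d = insertAt d′ L b
  Joins : Fin (suc n) → Fin (suc n) → Set
  Joins i j = adj H (σ ⟨$⟩ʳ j) (σ ⟨$⟩ʳ i) ≡ d j

  at-last : ∀ k → Joins (punchIn L k) L
  at-last k rewrite insert-pivot L w σ′ | insert-punchIn L w σ′ k | insertAt-lookup d′ L b =
    trans (adj-sym H _ _) (uniform _ (punchInᵢ≢i w _))

  inside : ∀ k l → k < l → Joins (punchIn L k) (punchIn L l)
  inside k l k<l rewrite insert-punchIn L w σ′ k | insert-punchIn L w σ′ l
                       | insertAt-punchIn d′ L b l = joins′ k l k<l

threshold⇒creation : ∀ {n} (H : Graph n) → IsThreshold H → CreationSequence H
threshold⇒creation {zero} H _ = Perm.id , (λ ()) , λ ()
threshold⇒creation {suc n} H threshold with threshold (λ _ → true) (zero , refl)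
... | w , _ , iso-or-univ with isolated-or-universal⇒uniform H iso-or-univ
...   | b , uniform =
  append-uniform-vertex H w b (λ u → uniform u refl)
    (threshold⇒creation (deleteVertex H w) (deleteVertex-threshold H w threshold))

theorem8 : ∀ (n : ℕ) (G : Graph n) →
    (∃ λ (H : Graph n) → IsThreshold H × SwitchingEquivalent G H) ⇔ IsRestricted2Threshold G
theorem8 n G = mk⇔ to from
  where
  to : (∃ λ (H : Graph n) → IsThreshold H × SwitchingEquivalent G H) → IsRestricted2Threshold G
  to (H , H-threshold , S , switched≈H) =
    S , Equivalence.from (coloured⇔switched-creation G S)
          (creation-transport H (switch G S) (λ u v → sym (switched≈H u v))
            (threshold⇒creation H H-threshold))

  from : IsRestricted2Threshold G → (∃ λ (H : Graph n) → IsThreshold H × SwitchingEquivalent G H)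
  from (c , ordering) =
    switch G c ,
    creation⇒threshold (switch G c) (Equivalence.to (coloured⇔switched-creation G c) ordering) ,
    c , λ _ _ → refl
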